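{- Let $\mathcal{A}$ be a bounded distributive lattice and $\to$ an implication over $\mathcal{A}$. Then: (i) $\to$ is open if and only if $a \leq b \to (a \wedge b)$ for all $a, b \in \mathcal{A}$. Moreover, if $\to$ is open, then $a \leq b \to a$ and $a \wedge \neg 1 = a \wedge \neg a$ for all $a, b \in \mathcal{A}$. (ii) $\to$ is closed if and only if $((a \vee b) \to a) \vee b = 1$ for all $a, b \in \mathcal{A}$. Moreover, if $\to$ is closed, then $b \vee \neg b = 1$ for all $b \in \mathcal{A}$. (iii) If $\to$ is closed, then for all $a, b, c \in \mathcal{A}$, $c \wedge a \leq b$ implies $c \leq \neg a \vee b$.
   Context: Let $\mathcal{A}=(A,\leq,\wedge,\vee,1,0)$ be a bounded distributive lattice. An implication over $\mathcal{A}$ is a binary operation $\to$ on $\mathcal{A}$ which is order-reversing in its first argument and order-preserving in its second argument and satisfies $a \to a = 1$ and $(a \to b) \wedge (b \to c) \leq a \to c$ for all $a,b,c \in \mathcal{A}$. For an implication, $\neg a$ abbreviates $a \to 0$. An implication is called open if for all $a,b,c$, $a \wedge b \leq c$ implies $a \leq b \to c$; it is called closed if for all $a,b,c$, $a \leq b \vee c$ implies $(a \to b) \vee c = 1$. -}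

module Defs where

open import Level using (Level; suc; _⊔_)
open import Algebra.Core using (Op₂)
open import Relation.Binary.Core using (Rel)
open import Algebra.Definitions using (_DistributesOverˡ_)
open import Relation.Binary.Lattice.Structures using (IsBoundedLattice)

record BoundedDistributiveLattice c ℓ₁ ℓ₂ : Set (suc (c ⊔ ℓ₁ ⊔ ℓ₂)) where
  infix  4 _≈_ _≤_
  infixr 6 _∨_
  infixr 7 _∧_
  field
    Carrier          : Set c
    _≈_              : Rel Carrier ℓ₁
    _≤_              : Rel Carrier ℓ₂
    _∨_              : Op₂ Carrier
    _∧_              : Op₂ Carrier
    ⊤                : Carrier
    ⊥                : Carrier
    isBoundedLattice : IsBoundedLattice _≈_ _≤_ _∨_ _∧_ ⊤ ⊥
    ∧-distribˡ-∨     : _DistributesOverˡ_ _≈_ _∧_ _∨_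

  open IsBoundedLattice isBoundedLattice public

module _ {c ℓ₁ ℓ₂} (L : BoundedDistributiveLattice c ℓ₁ ℓ₂) where
  open BoundedDistributiveLattice L

  record IsImplication (_⇒_ : Op₂ Carrier) : Set (c ⊔ ℓ₁ ⊔ ℓ₂) where
    field
      antitoneˡ : ∀ {a a′ b} → a ≤ a′ → (a′ ⇒ b) ≤ (a ⇒ b)
      monotoneʳ : ∀ {a b b′} → b ≤ b′ → (a ⇒ b) ≤ (a ⇒ b′)
      refl⇒     : ∀ a → (a ⇒ a) ≈ ⊤
      trans⇒    : ∀ a b c → ((a ⇒ b) ∧ (b ⇒ c)) ≤ (a ⇒ c)

  neg : Op₂ Carrier → Carrier → Carrier
  neg _⇒_ a = a ⇒ ⊥

  IsOpen : Op₂ Carrier → Set (c ⊔ ℓ₂)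
  IsOpen _⇒_ = ∀ a b c → (a ∧ b) ≤ c → a ≤ (b ⇒ c)

  IsClosed : Op₂ Carrier → Set (c ⊔ ℓ₁ ⊔ ℓ₂)
  IsClosed _⇒_ = ∀ a b c → a ≤ (b ∨ c) → ((a ⇒ b) ∨ c) ≈ ⊤

{-# OPTIONS --safe #-}
module Submission where

-- Openness and closedness each reduce to a single instance (c = a ∧ b, resp.
-- a = b ∨ c), since the other instances follow by monotonicity of ⇒ in its
-- second, resp. antitonicity in its first, argument. Closedness at a ≤ ⊥ ∨ a
-- yields ¬ a ∨ a = ⊤, and distributivity turns this into the shunting rule (iii).

open import Defs
open import Data.Product using (_×_; _,_)
open import Function.Bundles using (_⇔_; mk⇔)
open import Algebra.Core using (Op₂)
open import Relation.Binary.Lattice.Bundles using (BoundedLattice)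
import Relation.Binary.Lattice.Properties.JoinSemilattice as JoinSemilatticeProperties
import Relation.Binary.Lattice.Properties.MeetSemilattice as MeetSemilatticeProperties
import Relation.Binary.Reasoning.PartialOrder as PartialOrderReasoning

module BoundedDistributiveLatticeProperties
  {c ℓ₁ ℓ₂} (L : BoundedDistributiveLattice c ℓ₁ ℓ₂) where

  open BoundedDistributiveLattice L

  boundedLattice : BoundedLattice c ℓ₁ ℓ₂
  boundedLattice = record { isBoundedLattice = isBoundedLattice }

  open BoundedLattice boundedLattice
    using (joinSemilattice; meetSemilattice; poset)
  open JoinSemilatticeProperties joinSemilattice public
    using (∨-comm; ∨-monotonic)
  open MeetSemilatticeProperties meetSemilattice public
    using (∧-monotonic)

  ⊤≤⇒≈⊤ : ∀ {x} → ⊤ ≤ x → x ≈ ⊤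
  ⊤≤⇒≈⊤ = antisym (maximum _)

  ≈⊤⇒⊤≤ : ∀ {x} → x ≈ ⊤ → ⊤ ≤ x
  ≈⊤⇒⊤≤ x≈⊤ = reflexive (Eq.sym x≈⊤)

  ∧≤⇒≤∨ : ∀ {x y z w} → w ∨ y ≈ ⊤ → x ∧ y ≤ z → x ≤ w ∨ z
  ∧≤⇒≤∨ {x} {y} {z} {w} w∨y≈⊤ x∧y≤z = begin
    x                  ≤⟨ ∧-greatest refl (trans (maximum x) (≈⊤⇒⊤≤ w∨y≈⊤)) ⟩
    x ∧ (w ∨ y)        ≈⟨ ∧-distribˡ-∨ x w y ⟩
    (x ∧ w) ∨ (x ∧ y)  ≤⟨ ∨-monotonic (x∧y≤y x w) x∧y≤z ⟩
    w ∨ z              ∎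
    where open PartialOrderReasoning poset

module ImplicationProperties
  {c ℓ₁ ℓ₂} (L : BoundedDistributiveLattice c ℓ₁ ℓ₂)
  (_⇒_ : Op₂ (BoundedDistributiveLattice.Carrier L))
  (imp : IsImplication L _⇒_) where

  open BoundedDistributiveLattice L
  open BoundedDistributiveLatticeProperties L
  open IsImplication imp

  infix 8 ¬_
  ¬_ : Carrier → Carrier
  ¬_ = neg L _⇒_

  isOpen⇒x≤y⇒x∧y : IsOpen L _⇒_ → ∀ x y → x ≤ y ⇒ (x ∧ y)
  isOpen⇒x≤y⇒x∧y isOpen x y = isOpen x y (x ∧ y) refl

  x≤y⇒x∧y⇒isOpen : (∀ x y → x ≤ y ⇒ (x ∧ y)) → IsOpen L _⇒_
  x≤y⇒x∧y⇒isOpen unit x y z x∧y≤z = trans (unit x y) (monotoneʳ x∧y≤z)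

  isOpen⇒x≤y⇒x : IsOpen L _⇒_ → ∀ x y → x ≤ y ⇒ x
  isOpen⇒x≤y⇒x isOpen x y = isOpen x y x (x∧y≤x x y)

  x≤⊤⇒x⇒x∧[⊤⇒z]≈x∧[x⇒z] : ∀ {x} z → x ≤ ⊤ ⇒ x → x ∧ (⊤ ⇒ z) ≈ x ∧ (x ⇒ z)
  x≤⊤⇒x⇒x∧[⊤⇒z]≈x∧[x⇒z] {x} z x≤⊤⇒x = antisym
    (∧-monotonic refl (antitoneˡ (maximum x)))
    (∧-greatest (x∧y≤x x (x ⇒ z))
      (trans (∧-monotonic x≤⊤⇒x refl) (trans⇒ ⊤ x z)))

  isClosed⇒[x∨y⇒x]∨y≈⊤ : IsClosed L _⇒_ → ∀ x y → ((x ∨ y) ⇒ x) ∨ y ≈ ⊤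
  isClosed⇒[x∨y⇒x]∨y≈⊤ isClosed x y = isClosed (x ∨ y) x y refl

  [x∨y⇒x]∨y≈⊤⇒isClosed : (∀ x y → ((x ∨ y) ⇒ x) ∨ y ≈ ⊤) → IsClosed L _⇒_
  [x∨y⇒x]∨y≈⊤⇒isClosed counit x y z x≤y∨z = ⊤≤⇒≈⊤
    (trans (≈⊤⇒⊤≤ (counit y z)) (∨-monotonic (antitoneˡ x≤y∨z) refl))

  isClosed⇒¬x∨x≈⊤ : IsClosed L _⇒_ → ∀ x → ¬ x ∨ x ≈ ⊤
  isClosed⇒¬x∨x≈⊤ isClosed x = isClosed x ⊥ x (y≤x∨y ⊥ x)

  isClosed⇒x∨¬x≈⊤ : IsClosed L _⇒_ → ∀ x → x ∨ ¬ x ≈ ⊤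
  isClosed⇒x∨¬x≈⊤ isClosed x = Eq.trans (∨-comm x (¬ x)) (isClosed⇒¬x∨x≈⊤ isClosed x)

  isClosed⇒x∧y≤z⇒x≤¬y∨z : IsClosed L _⇒_ → ∀ y z x → x ∧ y ≤ z → x ≤ ¬ y ∨ z
  isClosed⇒x∧y≤z⇒x≤¬y∨z isClosed y z x = ∧≤⇒≤∨ (isClosed⇒¬x∨x≈⊤ isClosed y)

lemma3p3 : ∀ {c ℓ₁ ℓ₂} (L : BoundedDistributiveLattice c ℓ₁ ℓ₂)
             (_⇒_ : Op₂ (BoundedDistributiveLattice.Carrier L)) →
             IsImplication L _⇒_ →
             let open BoundedDistributiveLattice L in
             -- (i)
             ((IsOpen L _⇒_ ⇔ (∀ a b → a ≤ (b ⇒ (a ∧ b))))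
               × (IsOpen L _⇒_ →
                    (∀ a b → a ≤ (b ⇒ a))
                    × (∀ a → (a ∧ neg L _⇒_ ⊤) ≈ (a ∧ neg L _⇒_ a))))
             -- (ii)
             × ((IsClosed L _⇒_ ⇔ (∀ a b → (((a ∨ b) ⇒ a) ∨ b) ≈ ⊤))
               × (IsClosed L _⇒_ → ∀ b → (b ∨ neg L _⇒_ b) ≈ ⊤))
             -- (iii)
             × (IsClosed L _⇒_ →
                  ∀ a b c → (c ∧ a) ≤ b → c ≤ (neg L _⇒_ a ∨ b))
lemma3p3 L _⇒_ imp =
    ( mk⇔ isOpen⇒x≤y⇒x∧y x≤y⇒x∧y⇒isOpen
    , λ isOpen → isOpen⇒x≤y⇒x isOpen
              , λ a → x≤⊤⇒x⇒x∧[⊤⇒z]≈x∧[x⇒z] ⊥ (isOpen⇒x≤y⇒x isOpen a ⊤) )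
  , ( mk⇔ isClosed⇒[x∨y⇒x]∨y≈⊤ [x∨y⇒x]∨y≈⊤⇒isClosed
    , isClosed⇒x∨¬x≈⊤ )
  , isClosed⇒x∧y≤z⇒x≤¬y∨z
  where
  open BoundedDistributiveLattice L
  open ImplicationProperties L _⇒_ imp
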